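{- Let $\mathbf S=(S,\leq,*,1)$ be a skew Hilbert algebra with bottom element $0$. Put $x':=x*0$, $S':=\{x'\mid x\in S\}$, $D(\mathbf S):=\{x\in S\mid x'=0\}$ and $W(\mathbf S):=\{x\in S\mid x=y''*y\text{ for some }y\in S\}$. Then: (i) $S'\cap D(\mathbf S)=\{1\}$; (ii) $D(\mathbf S)$ is an upper subset of $(S,\leq)$; (iii) $(D(\mathbf S),\leq,*,1)$ is a skew Hilbert subalgebra of $\mathbf S$; (iv) $D(\mathbf S)\subseteq W(\mathbf S)$; (v) $S'\cap W(\mathbf S)=\{1\}$.
   Context: For a poset and a subset $A$, $L(A)$, $U(A)$ are the sets of lower and upper bounds; $L(U(x,y),z)=L(U(\{x,y\})\cup\{z\})$. A skew Hilbert algebra is a poset $(S,\leq,*,1)$ with binary operation $*$ and constant $1$ such that for all $x,y,z$: (S1) $x\leq y$ iff $x*y=1$; (S2) if $y*x=1$ then $x*((x*y)*y)=1$; (S3) if $x*y=1$ then $(y*z)*(x*z)=1$; (S4) $L(U(x,y),x*y)=L(y)$. Here $y''=(y*0)*0$. -}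

module Defs where

open import Data.Product using (Σ; ∃; _×_; _,_; proj₁)
open import Function.Bundles using (_⇔_)
open import Relation.Binary.Structures using (IsPartialOrder)
open import Relation.Binary.PropositionalEquality using (_≡_)

record IsSkewHilbertAlgebra (A : Set) (_≈_ : A → A → Set) (_≤_ : A → A → Set)
                            (_*_ : A → A → A) (one : A) : Set₁ where
  field
    isPartialOrder : IsPartialOrder _≈_ _≤_
    S1 : ∀ x y → (x ≤ y) ⇔ ((x * y) ≈ one)
    S2 : ∀ x y → (y * x) ≈ one → (x * ((x * y) * y)) ≈ one
    S3 : ∀ x y z → (x * y) ≈ one → ((y * z) * (x * z)) ≈ one
    -- (S4) L(U(x,y), x * y) = L(y), as equality of subsets:
    --      a ∈ L(U({x,y}) ∪ {x*y})  iff  a ∈ L({y})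
    S4 : ∀ x y a →
         ((∀ u → x ≤ u → y ≤ u → a ≤ u) × (a ≤ (x * y))) ⇔ (a ≤ y)

record SkewHilbertAlgebra : Set₁ where
  field
    Carrier : Set
    _≤_ : Carrier → Carrier → Set
    _*_ : Carrier → Carrier → Carrier
    one : Carrier
    isSkewHilbertAlgebra : IsSkewHilbertAlgebra Carrier _≡_ _≤_ _*_ one
  open IsSkewHilbertAlgebra isSkewHilbertAlgebra public

module _ (𝐒 : SkewHilbertAlgebra) where
  open SkewHilbertAlgebra 𝐒

  IsBottom : Carrier → Set
  IsBottom z = ∀ x → z ≤ x

  IsUpperSubset : (Carrier → Set) → Set
  IsUpperSubset P = ∀ x y → P x → x ≤ y → P y

  IsSkewHilbertSubalgebra : (Carrier → Set) → Set₁
  IsSkewHilbertSubalgebra P =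
    Σ (P one) λ p1 →
    Σ (∀ x y → P x → P y → P (x * y)) λ closed →
      IsSkewHilbertAlgebra (Σ Carrier P)
        (λ a b → proj₁ a ≡ proj₁ b)
        (λ a b → proj₁ a ≤ proj₁ b)
        (λ { (x , px) (y , py) → (x * y) , closed x y px py })
        (one , p1)

  module WithZero (zero : Carrier) where
    _′ : Carrier → Carrier
    x ′ = x * zero

    S′ : Carrier → Set
    S′ x = ∃ λ y → x ≡ y ′

    D : Carrier → Set
    D x = x ′ ≡ zero

    W : Carrier → Set
    W x = ∃ λ y → x ≡ ((y ′) ′) * y

-- Negation x ↦ x′ is antitone with x ≤ x′′, so x′′′ = x′: elements of S′ are fixed by
-- double negation. An element of S′ ∩ D is therefore 0′ = 1, and one of S′ ∩ W of the
-- form y′′ * y forces y′′ ≤ y, i.e. y′′ = y and the element is y * y = 1. D is an upper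
-- subset because negation is antitone, and an upper subset containing 1 is a subalgebra.
module Submission where

open import Defs
open import Data.Product using (_×_; _,_; proj₁; proj₂; uncurry)
open import Function.Bundles using (_⇔_; mk⇔; Equivalence)
open import Relation.Binary.PropositionalEquality
  using (_≡_; refl; sym; cong; subst; module ≡-Reasoning)
open import Relation.Binary.Structures using (IsPartialOrder)
import Relation.Binary.Construct.On as On

module SkewHilbertAlgebraProperties (𝐒 : SkewHilbertAlgebra) where
  open SkewHilbertAlgebra 𝐒
  open IsPartialOrder isPartialOrder using (antisym; trans) renaming (refl to ≤-refl)

  ≤⇒*≡one : ∀ {x y} → x ≤ y → (x * y) ≡ one
  ≤⇒*≡one = Equivalence.to (S1 _ _)

  *≡one⇒≤ : ∀ {x y} → (x * y) ≡ one → x ≤ y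
  *≡one⇒≤ = Equivalence.from (S1 _ _)

  y≤x*y : ∀ x y → y ≤ (x * y)
  y≤x*y x y = proj₂ (Equivalence.from (S4 x y y) ≤-refl)

  x≤one : ∀ x → x ≤ one
  x≤one x = subst (x ≤_) (≤⇒*≡one ≤-refl) (y≤x*y x x)

  *-antitoneˡ : ∀ {x y z} → x ≤ y → (y * z) ≤ (x * z)
  *-antitoneˡ {x} {y} {z} x≤y = *≡one⇒≤ (S3 x y z (≤⇒*≡one x≤y))

  *-identityˡ : ∀ x → (one * x) ≡ x
  *-identityˡ x = antisym one*x≤x (y≤x*y one x)
    where
    one*x≤x : (one * x) ≤ x
    one*x≤x = Equivalence.to (S4 one x (one * x))
                ((λ u one≤u _ → trans (x≤one _) one≤u) , ≤-refl)

  x≤x*y⇒x≤y : ∀ {x y} → x ≤ (x * y) → x ≤ y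
  x≤x*y⇒x≤y {x} {y} x≤x*y = Equivalence.to (S4 x y x) ((λ _ x≤u _ → x≤u) , x≤x*y)

  -- Within an upper subset every bound of (S4) taken in S already lies in the subset,
  -- so (S4) restricts; the other axioms restrict verbatim.
  upperSubset⇒subalgebra : ∀ {P} → IsUpperSubset 𝐒 P → P one → IsSkewHilbertSubalgebra 𝐒 P
  upperSubset⇒subalgebra {P} upper P-one = P-one , closed , record
    { isPartialOrder = On.isPartialOrder proj₁ isPartialOrder
    ; S1 = λ { (x , _) (y , _) → S1 x y }
    ; S2 = λ { (x , _) (y , _) → S2 x y }
    ; S3 = λ { (x , _) (y , _) (z , _) → S3 x y z }
    ; S4 = λ { (x , Px) (y , _) (a , _) → mk⇔
        (λ (bounded , a≤x*y) → Equivalence.to (S4 x y a)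
          ((λ u x≤u y≤u → bounded (u , upper x u Px x≤u) x≤u y≤u) , a≤x*y))
        (λ a≤y → (λ _ _ y≤u → trans a≤y y≤u) , trans a≤y (y≤x*y x y)) }
    }
    where
    closed : ∀ x y → P x → P y → P (x * y)
    closed x y _ Py = upper y (x * y) Py (y≤x*y x y)

module SkewHilbertAlgebraWithBottom
  (𝐒 : SkewHilbertAlgebra) (zero : SkewHilbertAlgebra.Carrier 𝐒) (bottom : IsBottom 𝐒 zero)
  where
  open SkewHilbertAlgebra 𝐒
  open IsPartialOrder isPartialOrder using (antisym) renaming (refl to ≤-refl)
  open WithZero 𝐒 zero
  open SkewHilbertAlgebraProperties 𝐒
  open ≡-Reasoning

  zero′≡one : (zero ′) ≡ one
  zero′≡one = ≤⇒*≡one (bottom zero)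

  ′-antitone : ∀ {x y} → x ≤ y → (y ′) ≤ (x ′)
  ′-antitone = *-antitoneˡ

  x≤x′′ : ∀ x → x ≤ (x ′ ′)
  x≤x′′ x = *≡one⇒≤ (S2 x zero (≤⇒*≡one (bottom x)))

  x′′′≡x′ : ∀ x → (x ′ ′ ′) ≡ (x ′)
  x′′′≡x′ x = antisym (′-antitone (x≤x′′ x)) (x≤x′′ (x ′))

  S′⇒x′′≡x : ∀ {x} → S′ x → (x ′ ′) ≡ x
  S′⇒x′′≡x (y , refl) = x′′′≡x′ y

  one∈S′ : S′ one
  one∈S′ = zero , sym zero′≡one

  one∈D : D one
  one∈D = *-identityˡ zero

  one∈W : W one
  one∈W = one , sym (≤⇒*≡one (x≤one _))

  S′∩D⇒≡one : ∀ {x} → S′ x → D x → x ≡ one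
  S′∩D⇒≡one {x} x∈S′ x′≡zero = begin
    x        ≡⟨ sym (S′⇒x′′≡x x∈S′) ⟩
    x ′ ′    ≡⟨ cong _′ x′≡zero ⟩
    zero ′   ≡⟨ zero′≡one ⟩
    one      ∎

  D-upper : IsUpperSubset 𝐒 D
  D-upper x y x′≡zero x≤y =
    antisym (subst ((y ′) ≤_) x′≡zero (′-antitone x≤y)) (bottom (y ′))

  D⊆W : ∀ {x} → D x → W x
  D⊆W {x} x′≡zero = x , sym (begin
    (x ′ ′) * x  ≡⟨ cong (λ t → (t ′) * x) x′≡zero ⟩
    (zero ′) * x ≡⟨ cong (_* x) zero′≡one ⟩
    one * x      ≡⟨ *-identityˡ x ⟩
    x            ∎)

  -- With u = y′′ * y ∈ S′ we get y′′ ≤ u′′ = u, hence y′′ ≤ y, so y′′ = y and u = y * y = 1.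
  S′∩W⇒≡one : ∀ {x} → S′ x → W x → x ≡ one
  S′∩W⇒≡one x∈S′ (y , refl) = begin
    (y ′ ′) * y  ≡⟨ cong (_* y) y′′≡y ⟩
    y * y        ≡⟨ ≤⇒*≡one ≤-refl ⟩
    one          ∎
    where
    u′′≡u : (((y ′ ′) * y) ′ ′) ≡ ((y ′ ′) * y)
    u′′≡u = S′⇒x′′≡x x∈S′

    y′′≡y : (y ′ ′) ≡ y
    y′′≡y = antisym
      (x≤x*y⇒x≤y (subst ((y ′ ′) ≤_) u′′≡u (′-antitone (′-antitone (y≤x*y (y ′ ′) y)))))
      (x≤x′′ y)

mainTheorem6 : (𝐒 : SkewHilbertAlgebra) → (zero : SkewHilbertAlgebra.Carrier 𝐒) →
    IsBottom 𝐒 zero →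
    let open SkewHilbertAlgebra 𝐒
        open WithZero 𝐒 zero
    in ((∀ x → (S′ x × D x) ⇔ (x ≡ one))
       × IsUpperSubset 𝐒 D
       × IsSkewHilbertSubalgebra 𝐒 D
       × (∀ x → D x → W x)
       × (∀ x → (S′ x × W x) ⇔ (x ≡ one)))
mainTheorem6 𝐒 zero bottom =
    (λ _ → mk⇔ (uncurry S′∩D⇒≡one) λ { refl → one∈S′ , one∈D })
  , D-upper
  , upperSubset⇒subalgebra D-upper one∈D
  , (λ _ → D⊆W)
  , (λ _ → mk⇔ (uncurry S′∩W⇒≡one) λ { refl → one∈S′ , one∈W })
  where
  open SkewHilbertAlgebraProperties 𝐒
  open SkewHilbertAlgebraWithBottom 𝐒 zero bottom
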